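{- A language $L\subseteq\Sigma^*$ is weakly acyclic if and only if it is described by a weakly acyclic expression.
   Context: A DFA $(Q,\Sigma,\delta,q_0,F)$ is weakly acyclic if for every $q\in Q$, nonempty word $w$ and letter $c$ occurring in $w$, $\delta(q,w)=q$ implies $\delta(q,c)=q$. An NFA $(Q,\Sigma,\delta,q_0,F)$ is weakly acyclic if for every $q\in Q$ and nonempty word $w$, $q\in\delta(q,w)$ implies $\delta(q,c)=\{q\}$ for every letter $c$ occurring in $w$. A language is weakly acyclic if it is accepted by a weakly acyclic automaton (DFA or NFA; these give the same class). Weakly acyclic expressions over $\Sigma$ are generated by the grammar $r ::= \emptyset \mid \Gamma^* \mid \Lambda^* a\, r \mid r + r$, where $\Gamma,\Lambda\subseteq\Sigma$ and $a\in\Sigma\setminus\Lambda$, with the usual regular-expression semantics. -}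

module Defs where

open import Data.Nat using (ℕ)
open import Data.Fin using (Fin)
open import Data.Bool using (Bool; true; false)
open import Data.List using (List; []; _∷_; _++_)
open import Data.List.Relation.Unary.All using (All)
open import Data.List.Membership.Propositional using (_∈_)
open import Data.Product using (Σ; ∃; ∃-syntax; _×_; _,_)
open import Data.Sum using (_⊎_)
open import Data.Empty using (⊥)
open import Relation.Binary.PropositionalEquality using (_≡_; _≢_)
open import Function.Bundles using (_⇔_)

Word : ℕ → Set
Word k = List (Fin k)

Language : ℕ → Set₁
Language k = Word k → Set

_≐_ : ∀ {k} → Language k → Language k → Set
L ≐ M = ∀ w → L w ⇔ M w

record DFA (k : ℕ) : Set where
  field
    n  : ℕ
    δ  : Fin n → Fin k → Fin n
    q₀ : Fin n
    F  : Fin n → Bool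

module _ {k : ℕ} (A : DFA k) where
  open DFA A

  δ* : Fin n → Word k → Fin n
  δ* q []      = q
  δ* q (c ∷ w) = δ* (δ q c) w

  DFA-lang : Language k
  DFA-lang w = F (δ* q₀ w) ≡ true

  DFA-WeaklyAcyclic : Set
  DFA-WeaklyAcyclic =
    ∀ (q : Fin n) (w : Word k) (c : Fin k) →
      w ≢ [] → c ∈ w → δ* q w ≡ q → δ q c ≡ q

-- NFAs with finitely many states Fin n; transition relation δ q c p
-- means p ∈ δ(q,c).

record NFA (k : ℕ) : Set where
  field
    n  : ℕ
    δ  : Fin n → Fin k → Fin n → Bool
    q₀ : Fin n
    F  : Fin n → Bool

module _ {k : ℕ} (A : NFA k) where
  open NFA A

  data Reach : Fin n → Word k → Fin n → Set where
    reach-[] : ∀ {q} → Reach q [] q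
    reach-∷  : ∀ {q c w p r} → δ q c p ≡ true → Reach p w r → Reach q (c ∷ w) r

  NFA-lang : Language k
  NFA-lang w = ∃[ p ] (Reach q₀ w p × F p ≡ true)

  NFA-WeaklyAcyclic : Set
  NFA-WeaklyAcyclic =
    ∀ (q : Fin n) (w : Word k) → w ≢ [] → Reach q w q →
      ∀ (c : Fin k) → c ∈ w → ∀ (p : Fin n) → (δ q c p ≡ true ⇔ p ≡ q)

WeaklyAcyclicLanguage : ∀ {k} → Language k → Set
WeaklyAcyclicLanguage {k} L =
  (Σ (DFA k) λ A → DFA-WeaklyAcyclic A × (L ≐ DFA-lang A))
  ⊎ (Σ (NFA k) λ A → NFA-WeaklyAcyclic A × (L ≐ NFA-lang A))

data WAExpr (k : ℕ) : Set where
  ∅     : WAExpr k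
  _*    : (Γ : Fin k → Bool) → WAExpr k
  _*·_·_ : (Λ : Fin k → Bool) (a : Fin k) → Λ a ≡ false → WAExpr k → WAExpr k
  _⊕_   : WAExpr k → WAExpr k → WAExpr k

_∈*_ : ∀ {k} → Word k → (Fin k → Bool) → Set
w ∈* Γ = All (λ c → Γ c ≡ true) w

⟦_⟧ : ∀ {k} → WAExpr k → Language k
⟦ ∅ ⟧ w = ⊥
⟦ Γ * ⟧ w = w ∈* Γ
⟦ (Λ *· a · _) r ⟧ w = ∃[ u ] ∃[ v ] (w ≡ u ++ (a ∷ v) × u ∈* Λ × ⟦ r ⟧ v)
⟦ r ⊕ s ⟧ w = ⟦ r ⟧ w ⊎ ⟦ s ⟧ w

{-# OPTIONS --safe #-}
-- In a weakly acyclic NFA a state q that loops on a letter c has δ(q,c) = {q}, and a run that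
-- leaves q never returns to it. Writing Γ_q for the loop letters of q, the language L_q accepted
-- from q therefore satisfies
--   L_q = [q final] Γ_q* + Σ { Γ_q* a L_p | a ∉ Γ_q, p ∈ δ(q,a) },
-- and since a run leaves at most n states behind, unfolding this equation n times gives an
-- expression. Conversely Γ* is recognised by a single looping state, Λ* a r by a fresh initial
-- state with Λ-loops and an a-edge into an automaton for r, and r + s by a fresh initial state
-- branching into automata for r and s; none of these constructions closes a new cycle.
module Submission where

open import Defs
open import Data.Nat using (ℕ; zero; suc; _+_; _≤_)
open import Data.Nat.Properties using (≤-pred; <-≤-trans; n≮0)
open import Data.Fin using (Fin; zero; suc)
import Data.Fin as Fin
open import Data.Fin.Properties using (1↔⊤; +↔⊎)
open import Data.Fin.Subset using (Subset; _-_; ∣_∣) renaming (⊤ to full; _∈_ to _∈ₛ_)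
open import Data.Fin.Subset.Properties using (∈⊤; ∣p∣≤n; x∈p⇒∣p-x∣<∣p∣; x∈p∧x≢y⇒x∈p-y)
open import Data.Bool using (Bool; true; false)
import Data.Bool as Bool
open import Data.Unit using (⊤; tt)
open import Data.Empty using (⊥)
open import Data.List using ([]; _∷_; _++_)
open import Data.List.Membership.Propositional using (_∈_)
open import Data.List.Relation.Unary.All using ([]; _∷_)
import Data.List.Relation.Unary.All as All
open import Data.List.Relation.Unary.Any using (here)
open import Data.Product using (Σ; ∃-syntax; _×_; _,_; proj₂)
open import Data.Product.Function.NonDependent.Propositional using (_×-⇔_)
open import Data.Product.Function.Dependent.Propositional using (congˡ)
open import Data.Sum using (_⊎_; inj₁; inj₂)
open import Data.Sum.Function.Propositional using (_⊎-⇔_; _⊎-↔_)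
open import Data.Sum.Properties using (inj₁-injective; inj₂-injective)
open import Function using (_∘_)
open import Function.Bundles using (_⇔_; mk⇔; Equivalence; _↔_; Inverse; Injection)
open import Function.Construct.Composition using (_⇔-∘_; _↔-∘_)
open import Function.Construct.Identity using (⇔-id; ↔-id)
open import Function.Properties.Inverse using (↔⇒↣; ↔-sym)
open import Function.Related.Propositional using (equivalence)
open import Relation.Binary.Definitions using (DecidableEquality)
open import Relation.Binary.PropositionalEquality using (_≡_; _≢_; refl; sym; trans; subst; subst₂; cong)
open import Relation.Nullary using (¬_; contradiction; Dec; yes; no; does; _×-dec_; _⊎-dec_)
open import Relation.Nullary.Decidable using (via-injection)

open Equivalence using (to; from)

module _ {k : ℕ} where

  ≐-trans : {L M N : Language k} → L ≐ M → M ≐ N → L ≐ N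
  ≐-trans L≐M M≐N w = M≐N w ⇔-∘ L≐M w

  WA-NFA-Language : Language k → Set
  WA-NFA-Language L = Σ (NFA k) λ A → NFA-WeaklyAcyclic A × (L ≐ NFA-lang A)

  WA-NFA-Language-resp : {L M : Language k} → L ≐ M → WA-NFA-Language M → WA-NFA-Language L
  WA-NFA-Language-resp L≐M (A , wa , M≐A) = A , wa , ≐-trans L≐M M≐A

  Prefixed : (Fin k → Bool) → Fin k → Language k → Language k
  Prefixed Λ a L w = ∃[ u ] ∃[ v ] (w ≡ u ++ a ∷ v × u ∈* Λ × L v)

  ⨁ : ∀ {n} → (Fin n → WAExpr k) → WAExpr k
  ⨁ {zero}  f = ∅
  ⨁ {suc n} f = f zero ⊕ ⨁ (f ∘ suc)

  ⟦⨁⟧ : ∀ {n} {f : Fin n → WAExpr k} {w} → ⟦ ⨁ f ⟧ w ⇔ (∃[ i ] ⟦ f i ⟧ w)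
  ⟦⨁⟧ = mk⇔ summand include
    where
      summand : ∀ {n} {f : Fin n → WAExpr k} {w} → ⟦ ⨁ f ⟧ w → ∃[ i ] ⟦ f i ⟧ w
      summand {suc n} (inj₁ h) = zero , h
      summand {suc n} (inj₂ h) with i , h′ ← summand h = suc i , h′
      include : ∀ {n} {f : Fin n → WAExpr k} {w} → ∃[ i ] ⟦ f i ⟧ w → ⟦ ⨁ f ⟧ w
      include (zero  , h) = inj₁ h
      include (suc i , h) = inj₂ (include (i , h))

  guard : Bool → WAExpr k → WAExpr k
  guard true  r = r
  guard false r = ∅

  ⟦guard⟧ : ∀ {b r w} → ⟦ guard b r ⟧ w ⇔ (b ≡ true × ⟦ r ⟧ w)
  ⟦guard⟧ {true}  = mk⇔ (refl ,_) (λ (_ , h) → h)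
  ⟦guard⟧ {false} = mk⇔ (λ ()) (λ ())

  -- b stands for Λ a; matching on it supplies the proof of Λ a ≡ false that _*·_·_ requires.
  *·-if : (Λ : Fin k → Bool) (a : Fin k) (b : Bool) → Λ a ≡ b → WAExpr k → WAExpr k
  *·-if Λ a true  _   r = ∅
  *·-if Λ a false a∉Λ r = (Λ *· a · a∉Λ) r

  ⟦*·-if⟧ : ∀ {Λ a b} (Λa≡b : Λ a ≡ b) {r w} →
    ⟦ *·-if Λ a b Λa≡b r ⟧ w ⇔ (Λ a ≡ false × Prefixed Λ a ⟦ r ⟧ w)
  ⟦*·-if⟧ {b = true}  a∈Λ = mk⇔ (λ ()) (λ (a∉Λ , _) → contradiction (trans (sym a∈Λ) a∉Λ) λ ())
  ⟦*·-if⟧ {b = false} a∉Λ = mk⇔ (a∉Λ ,_) proj₂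

-- Weakly acyclic NFAs to expressions

module FromNFA {k : ℕ} (A : NFA k) (wa : NFA-WeaklyAcyclic A) where
  open NFA A

  Γ : Fin n → Fin k → Bool
  Γ q c = δ q c q

  accepts-from : Fin n → Language k
  accepts-from q w = ∃[ p ] (Reach A q w p × F p ≡ true)

  Unfold : (Fin n → Language k) → Fin n → Language k
  Unfold L q w = (F q ≡ true × w ∈* Γ q)
               ⊎ ∃[ a ] ∃[ r ] (δ q a r ≡ true × Γ q a ≡ false × Prefixed (Γ q) a (L r) w)

  loop-deterministic : ∀ {q c p} → Γ q c ≡ true → δ q c p ≡ true → p ≡ q
  loop-deterministic loop step = to (wa _ (_ ∷ []) (λ ()) (reach-∷ loop reach-[]) _ (here refl) _) step

  no-return : ∀ {q a r w} → Γ q a ≡ false → δ q a r ≡ true → ¬ Reach A r w q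
  no-return no-loop step back =
    contradiction (trans (sym (from (wa _ (_ ∷ _) (λ ()) (reach-∷ step back) _ (here refl) _) refl)) no-loop) λ ()

  reach-loops : ∀ {q w} → w ∈* Γ q → Reach A q w q
  reach-loops []            = reach-[]
  reach-loops (loop ∷ rest) = reach-∷ loop (reach-loops rest)

  reach-++ : ∀ {q u p v r} → Reach A q u p → Reach A p v r → Reach A q (u ++ v) r
  reach-++ reach-[]          ρ = ρ
  reach-++ (reach-∷ step ρ₁) ρ = reach-∷ step (reach-++ ρ₁ ρ)

  Unfold-loop : ∀ {L q c w} → Γ q c ≡ true → Unfold L q w → Unfold L q (c ∷ w)
  Unfold-loop loop (inj₁ (final , us)) = inj₁ (final , loop ∷ us)
  Unfold-loop loop (inj₂ (a , r , step , no-loop , u , v , refl , us , h)) =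
    inj₂ (a , r , step , no-loop , _ ∷ u , v , refl , loop ∷ us , h)

  unfold : ∀ {q w} → accepts-from q w → Unfold accepts-from q w
  unfold (p , reach-[] , final) = inj₁ (final , [])
  unfold {q} (p , reach-∷ {c = c} {p = r} step ρ , final) with Γ q c in loop?
  ... | true with refl ← loop-deterministic loop? step = Unfold-loop loop? (unfold (p , ρ , final))
  ... | false = inj₂ (c , r , step , loop? , [] , _ , refl , [] , p , ρ , final)

  fold : ∀ {q w} → Unfold accepts-from q w → accepts-from q w
  fold {q} (inj₁ (final , us)) = q , reach-loops us , final
  fold (inj₂ (a , r , step , _ , u , v , refl , us , p , ρ , final)) =
    p , reach-++ (reach-loops us) (reach-∷ step ρ) , final

  expr : ℕ → Fin n → WAExpr k
  expr zero    q = ∅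
  expr (suc m) q =
    guard (F q) (Γ q *) ⊕ ⨁ λ a → ⨁ λ r → guard (δ q a r) (*·-if (Γ q) a (Γ q a) refl (expr m r))

  ⟦expr-suc⟧ : ∀ {m q w} → ⟦ expr (suc m) q ⟧ w ⇔ Unfold (λ r → ⟦ expr m r ⟧) q w
  ⟦expr-suc⟧ = ⟦guard⟧ ⊎-⇔ (∃-⇔ (∃-⇔ ((⇔-id _ ×-⇔ ⟦*·-if⟧ refl) ⇔-∘ ⟦guard⟧) ⇔-∘ ⟦⨁⟧) ⇔-∘ ⟦⨁⟧)
    where
      ∃-⇔ : ∀ {I : Set} {P Q : I → Set} → (∀ {i} → P i ⇔ Q i) → (∃[ i ] P i) ⇔ (∃[ i ] Q i)
      ∃-⇔ = congˡ {k = equivalence}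

  expr-sound : ∀ m {q w} → ⟦ expr m q ⟧ w → accepts-from q w
  expr-sound (suc m) h with to (⟦expr-suc⟧ {m}) h
  ... | inj₁ stay = fold (inj₁ stay)
  ... | inj₂ (a , r , step , no-loop , u , v , w≡ , us , h′) =
    fold (inj₂ (a , r , step , no-loop , u , v , w≡ , us , expr-sound m h′))

  -- S contains every state reachable from q. A run that leaves q never comes back, so S - q does
  -- the same for the successor, and ∣ S ∣ bounds the number of states a run can leave.
  expr-complete : ∀ m (S : Subset n) {q w} → ∣ S ∣ ≤ m → (∀ {v p} → Reach A q v p → p ∈ₛ S) →
    accepts-from q w → ⟦ expr m q ⟧ w
  expr-complete zero S ∣S∣≤0 closed _ =
    contradiction (<-≤-trans (x∈p⇒∣p-x∣<∣p∣ (closed reach-[])) ∣S∣≤0) n≮0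
  expr-complete (suc m) S {q} ∣S∣≤1+m closed h with unfold h
  ... | inj₁ stay = from (⟦expr-suc⟧ {m}) (inj₁ stay)
  ... | inj₂ (a , r , step , no-loop , u , v , w≡ , us , h′) =
    from (⟦expr-suc⟧ {m})
      (inj₂ (a , r , step , no-loop , u , v , w≡ , us , expr-complete m (S - q) shrinks closed′ h′))
    where
      shrinks : ∣ S - q ∣ ≤ m
      shrinks = ≤-pred (<-≤-trans (x∈p⇒∣p-x∣<∣p∣ (closed reach-[])) ∣S∣≤1+m)
      closed′ : ∀ {v p} → Reach A r v p → p ∈ₛ S - q
      closed′ ρ = x∈p∧x≢y⇒x∈p-y (closed (reach-∷ step ρ)) λ { refl → no-return no-loop step ρ }

  NFA-lang≐expr : NFA-lang A ≐ ⟦ expr n q₀ ⟧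
  NFA-lang≐expr w = mk⇔ (expr-complete n full (∣p∣≤n full) (λ _ → ∈⊤)) (expr-sound n)

NFA→WAExpr : ∀ {k} {L : Language k} → WA-NFA-Language L → ∃[ r ] (L ≐ ⟦ r ⟧)
NFA→WAExpr (A , wa , L≐A) = FromNFA.expr A wa _ _ , ≐-trans L≐A (FromNFA.NFA-lang≐expr A wa)

-- Expressions to weakly acyclic automata

-- State spaces are arbitrary types enumerated by Fin size, so that the constructions below can
-- form sums of state spaces instead of doing index arithmetic in Fin.
record Automaton (k : ℕ) : Set₁ where
  field
    State  : Set
    size   : ℕ
    enum   : Fin size ↔ State
    Edge   : State → Fin k → State → Set
    edge?  : ∀ q c p → Dec (Edge q c p)
    start  : State
    Final  : State → Set
    final? : ∀ q → Dec (Final q)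

  data Run : State → Word k → State → Set where
    ε   : ∀ {q} → Run q [] q
    _◅_ : ∀ {q c w p r} → Edge q c p → Run p w r → Run q (c ∷ w) r

  accepts : Language k
  accepts w = ∃[ p ] (Run start w p × Final p)

  WeaklyAcyclicAt : State → Set
  WeaklyAcyclicAt q = ∀ {w} → w ≢ [] → Run q w q → ∀ {c} → c ∈ w → ∀ p → Edge q c p ⇔ p ≡ q

  WeaklyAcyclic : Set
  WeaklyAcyclic = ∀ q → WeaklyAcyclicAt q

module _ {k : ℕ} {A : Automaton k} where
  open Automaton A

  _◅◅_ : ∀ {q u p v r} → Run q u p → Run p v r → Run q (u ++ v) r
  ε       ◅◅ ρ′ = ρ′
  (e ◅ ρ) ◅◅ ρ′ = e ◅ (ρ ◅◅ ρ′)

does≡true⇔ : ∀ {P : Set} (P? : Dec P) → does P? ≡ true ⇔ P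
does≡true⇔ (yes p) = mk⇔ (λ _ → p) (λ _ → refl)
does≡true⇔ (no ¬p) = mk⇔ (λ ()) (λ p → contradiction p ¬p)

module _ {k : ℕ} (A : Automaton k) where
  open Automaton A
  open Inverse enum using (strictlyInverseˡ) renaming (to to state; from to index)

  realise : NFA k
  realise = record
    { n  = size
    ; δ  = λ i c j → does (edge? (state i) c (state j))
    ; q₀ = index start
    ; F  = λ i → does (final? (state i))
    }

  realise-run : ∀ {i w j} → Reach realise i w j → Run (state i) w (state j)
  realise-run reach-[]                 = ε
  realise-run (reach-∷ {c = c} step ρ) = to (does≡true⇔ (edge? _ c _)) step ◅ realise-run ρ

  run-realise : ∀ {q w p} → Run q w p → Reach realise (index q) w (index p)
  run-realise ε = reach-[]
  run-realise (_◅_ {q} {c} {p = p} e ρ) = reach-∷ (from (does≡true⇔ (edge? _ c _)) e′) (run-realise ρ)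
    where
      e′ : Edge (state (index q)) c (state (index p))
      e′ = subst₂ (λ s t → Edge s c t) (sym (strictlyInverseˡ q)) (sym (strictlyInverseˡ p)) e

  realise-accepts : accepts ≐ NFA-lang realise
  realise-accepts w = mk⇔
    (λ (p , ρ , final) →
      index p , run-realise ρ , from (does≡true⇔ (final? _)) (subst Final (sym (strictlyInverseˡ p)) final))
    (λ (j , ρ , final) →
      state j , subst (λ s → Run s w (state j)) (strictlyInverseˡ start) (realise-run ρ) ,
      to (does≡true⇔ (final? _)) final)

  realise-weaklyAcyclic : WeaklyAcyclic → NFA-WeaklyAcyclic realise
  realise-weaklyAcyclic wa i w w≢[] ρ c c∈w j =
    (mk⇔ (Injection.injective (↔⇒↣ enum)) (cong state) ⇔-∘ wa (state i) w≢[] (realise-run ρ) c∈w (state j))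
      ⇔-∘ does≡true⇔ (edge? _ c _)

  Automaton→NFA : WeaklyAcyclic → WA-NFA-Language accepts
  Automaton→NFA wa = realise , realise-weaklyAcyclic wa , realise-accepts

module _ {k : ℕ} where
  open Automaton

  record _↪ᴬ_ (A B : Automaton k) : Set where
    field
      embed           : State A → State B
      embed-injective : ∀ {q p} → embed q ≡ embed p → q ≡ p
      embed-edge      : ∀ {q c p} → Edge A q c p ⇔ Edge B (embed q) c (embed p)
      embed-closed    : ∀ {q c s} → Edge B (embed q) c s → ∃[ p ] (s ≡ embed p)

  module _ {A B : Automaton k} (ι : A ↪ᴬ B) where
    open _↪ᴬ_ ι

    run-embed : ∀ {q w p} → Run A q w p → Run B (embed q) w (embed p)
    run-embed ε       = ε
    run-embed (e ◅ ρ) = to embed-edge e ◅ run-embed ρ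

    run-reflect : ∀ {s w t q} → Run B s w t → s ≡ embed q → ∃[ p ] (t ≡ embed p × Run A q w p)
    run-reflect ε       s≡ = _ , s≡ , ε
    run-reflect (e ◅ ρ) refl with _ , refl ← embed-closed e with p , t≡ , ρ′ ← run-reflect ρ refl =
      p , t≡ , from embed-edge e ◅ ρ′

    weaklyAcyclicAt-embed : ∀ {q} → WeaklyAcyclicAt A q → WeaklyAcyclicAt B (embed q)
    weaklyAcyclicAt-embed {q} wa w≢[] ρ {c} c∈w s with p , q≡p , ρ′ ← run-reflect ρ refl
      with refl ← embed-injective q≡p =
      mk⇔ (λ e → loop e (embed-closed e)) (λ { refl → to embed-edge (from (wa w≢[] ρ′ c∈w q) refl) })
      where
        loop : ∀ {s} → Edge B (embed q) c s → ∃[ p ] (s ≡ embed p) → s ≡ embed q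
        loop e (p , refl) = cong embed (to (wa w≢[] ρ′ c∈w p) (from embed-edge e))

module _ {k : ℕ} where
  open Automaton

  loops : (Fin k → Bool) → Bool → Automaton k
  loops Γ b = record
    { State = ⊤ ; size = 1 ; enum = 1↔⊤
    ; Edge = λ _ c _ → Γ c ≡ true ; edge? = λ _ c _ → Γ c Bool.≟ true
    ; start = tt
    ; Final = λ _ → b ≡ true ; final? = λ _ → b Bool.≟ true
    }

  module _ {Γ : Fin k → Bool} {b : Bool} where

    run-loops⇔ : ∀ {w} → Run (loops Γ b) tt w tt ⇔ w ∈* Γ
    run-loops⇔ = mk⇔ letters run
      where
        letters : ∀ {w} → Run (loops Γ b) tt w tt → w ∈* Γ
        letters ε       = []
        letters (e ◅ ρ) = e ∷ letters ρ
        run : ∀ {w} → w ∈* Γ → Run (loops Γ b) tt w tt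
        run []       = ε
        run (e ∷ es) = e ◅ run es

    loops-accepts : (λ w → b ≡ true × w ∈* Γ) ≐ accepts (loops Γ b)
    loops-accepts w =
      mk⇔ (λ (final , ws) → tt , from run-loops⇔ ws , final) (λ (_ , ρ , final) → final , to run-loops⇔ ρ)

    loops-weaklyAcyclic : WeaklyAcyclic (loops Γ b)
    loops-weaklyAcyclic _ _ ρ c∈w _ = mk⇔ (λ _ → refl) (λ _ → All.lookup (to run-loops⇔ ρ) c∈w)

pattern fresh = inj₁ tt

module Prefix {k : ℕ} (Λ : Fin k → Bool) (a : Fin k) (a∉Λ : Λ a ≡ false) (A : Automaton k) where
  open Automaton

  private
    Q : Set
    Q = ⊤ ⊎ State A

    _≟_ : DecidableEquality (State A)
    _≟_ = via-injection (↔⇒↣ (↔-sym (enum A))) Fin._≟_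

    Step : Q → Fin k → Q → Set
    Step fresh    c fresh    = Λ c ≡ true
    Step fresh    c (inj₂ p) = c ≡ a × p ≡ start A
    Step (inj₂ q) c fresh    = ⊥
    Step (inj₂ q) c (inj₂ p) = Edge A q c p

    step? : ∀ q c p → Dec (Step q c p)
    step? fresh    c fresh    = Λ c Bool.≟ true
    step? fresh    c (inj₂ p) = c Fin.≟ a ×-dec p ≟ start A
    step? (inj₂ q) c fresh    = no λ ()
    step? (inj₂ q) c (inj₂ p) = edge? A q c p

    Accepting : Q → Set
    Accepting fresh    = ⊥
    Accepting (inj₂ q) = Final A q

    accepting? : ∀ q → Dec (Accepting q)
    accepting? fresh    = no λ ()
    accepting? (inj₂ q) = final? A q

  prefix : Automaton k
  prefix = record
    { State = Q ; size = suc (size A) ; enum = (1↔⊤ ⊎-↔ enum A) ↔-∘ +↔⊎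
    ; Edge = Step ; edge? = step? ; start = fresh ; Final = Accepting ; final? = accepting?
    }

  old : A ↪ᴬ prefix
  old = record
    { embed = inj₂ ; embed-injective = inj₂-injective ; embed-edge = ⇔-id _
    ; embed-closed = λ { {s = inj₂ p} _ → p , refl }
    }

  run-fresh-fresh : ∀ {w} → Run prefix fresh w fresh → w ∈* Λ
  run-fresh-fresh ε = []
  run-fresh-fresh (_◅_ {p = fresh}  loop ρ) = loop ∷ run-fresh-fresh ρ
  run-fresh-fresh (_◅_ {p = inj₂ _} _    ρ) with () ← run-reflect old ρ refl

  run-fresh-old : ∀ {w p} → Run prefix fresh w (inj₂ p) → Prefixed Λ a (λ v → Run A (start A) v p) w
  run-fresh-old (_◅_ {p = fresh} loop ρ) with u , v , refl , us , ρ′ ← run-fresh-old ρ =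
    _ ∷ u , v , refl , loop ∷ us , ρ′
  run-fresh-old (_◅_ {p = inj₂ _} (refl , refl) ρ) with _ , refl , ρ′ ← run-reflect old ρ refl =
    [] , _ , refl , [] , ρ′

  run-fresh-loops : ∀ {u} → u ∈* Λ → Run prefix fresh u fresh
  run-fresh-loops []            = ε
  run-fresh-loops (loop ∷ rest) = loop ◅ run-fresh-loops rest

  prefix-accepts : Prefixed Λ a (accepts A) ≐ accepts prefix
  prefix-accepts w = mk⇔ run accepted
    where
      accepted : accepts prefix w → Prefixed Λ a (accepts A) w
      accepted (inj₂ p , ρ , final) with u , v , w≡ , us , ρ′ ← run-fresh-old ρ =
        u , v , w≡ , us , p , ρ′ , final
      run : Prefixed Λ a (accepts A) w → accepts prefix w
      run (u , v , refl , us , p , ρ , final) =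
        inj₂ p , run-fresh-loops us ◅◅ ((refl , refl) ◅ run-embed old ρ) , final

  prefix-weaklyAcyclic : WeaklyAcyclic A → WeaklyAcyclic prefix
  prefix-weaklyAcyclic wa (inj₂ q) = weaklyAcyclicAt-embed old (wa q)
  prefix-weaklyAcyclic wa fresh _ ρ {c} c∈w = out
    where
      c∈Λ : Λ c ≡ true
      c∈Λ = All.lookup (run-fresh-fresh ρ) c∈w
      out : ∀ s → Step fresh c s ⇔ s ≡ fresh
      out fresh    = mk⇔ (λ _ → refl) (λ _ → c∈Λ)
      out (inj₂ p) = mk⇔ (λ { (refl , _) → contradiction (trans (sym c∈Λ) a∉Λ) λ () }) λ ()

module Union {k : ℕ} (A B : Automaton k) where
  open Automaton

  private
    Q : Set
    Q = ⊤ ⊎ (State A ⊎ State B)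

    Step : Q → Fin k → Q → Set
    Step fresh           c (inj₂ (inj₁ p)) = Edge A (start A) c p
    Step fresh           c (inj₂ (inj₂ p)) = Edge B (start B) c p
    Step (inj₂ (inj₁ q)) c (inj₂ (inj₁ p)) = Edge A q c p
    Step (inj₂ (inj₂ q)) c (inj₂ (inj₂ p)) = Edge B q c p
    Step _               _ _               = ⊥

    step? : ∀ q c p → Dec (Step q c p)
    step? fresh           c (inj₂ (inj₁ p)) = edge? A (start A) c p
    step? fresh           c (inj₂ (inj₂ p)) = edge? B (start B) c p
    step? (inj₂ (inj₁ q)) c (inj₂ (inj₁ p)) = edge? A q c p
    step? (inj₂ (inj₂ q)) c (inj₂ (inj₂ p)) = edge? B q c p
    step? fresh           c fresh           = no λ ()
    step? (inj₂ (inj₁ q)) c fresh           = no λ ()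
    step? (inj₂ (inj₂ q)) c fresh           = no λ ()
    step? (inj₂ (inj₁ q)) c (inj₂ (inj₂ p)) = no λ ()
    step? (inj₂ (inj₂ q)) c (inj₂ (inj₁ p)) = no λ ()

    Accepting : Q → Set
    Accepting fresh           = Final A (start A) ⊎ Final B (start B)
    Accepting (inj₂ (inj₁ q)) = Final A q
    Accepting (inj₂ (inj₂ q)) = Final B q

    accepting? : ∀ q → Dec (Accepting q)
    accepting? fresh           = final? A (start A) ⊎-dec final? B (start B)
    accepting? (inj₂ (inj₁ q)) = final? A q
    accepting? (inj₂ (inj₂ q)) = final? B q

  union : Automaton k
  union = record
    { State = Q ; size = suc (size A + size B)
    ; enum = (1↔⊤ ⊎-↔ ((enum A ⊎-↔ enum B) ↔-∘ +↔⊎)) ↔-∘ +↔⊎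
    ; Edge = Step ; edge? = step? ; start = fresh ; Final = Accepting ; final? = accepting?
    }

  left : A ↪ᴬ union
  left = record
    { embed = inj₂ ∘ inj₁ ; embed-injective = inj₁-injective ∘ inj₂-injective ; embed-edge = ⇔-id _
    ; embed-closed = λ { {s = inj₂ (inj₁ p)} _ → p , refl }
    }

  right : B ↪ᴬ union
  right = record
    { embed = inj₂ ∘ inj₂ ; embed-injective = inj₂-injective ∘ inj₂-injective ; embed-edge = ⇔-id _
    ; embed-closed = λ { {s = inj₂ (inj₂ p)} _ → p , refl }
    }

  union-accepts : (λ w → accepts A w ⊎ accepts B w) ≐ accepts union
  union-accepts w = mk⇔ run accepted
    where
      accepted : accepts union w → accepts A w ⊎ accepts B w
      accepted (_ , ε , inj₁ final) = inj₁ (start A , ε , final)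
      accepted (_ , ε , inj₂ final) = inj₂ (start B , ε , final)
      accepted (_ , _◅_ {p = inj₂ (inj₁ _)} e ρ , final) with p , refl , ρ′ ← run-reflect left ρ refl =
        inj₁ (p , e ◅ ρ′ , final)
      accepted (_ , _◅_ {p = inj₂ (inj₂ _)} e ρ , final) with p , refl , ρ′ ← run-reflect right ρ refl =
        inj₂ (p , e ◅ ρ′ , final)
      run : accepts A w ⊎ accepts B w → accepts union w
      run (inj₁ (_ , ε , final))     = fresh , ε , inj₁ final
      run (inj₁ (p , e ◅ ρ , final)) = inj₂ (inj₁ p) , e ◅ run-embed left ρ , final
      run (inj₂ (_ , ε , final))     = fresh , ε , inj₂ final
      run (inj₂ (p , e ◅ ρ , final)) = inj₂ (inj₂ p) , e ◅ run-embed right ρ , final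

  union-weaklyAcyclic : WeaklyAcyclic A → WeaklyAcyclic B → WeaklyAcyclic union
  union-weaklyAcyclic waA waB (inj₂ (inj₁ q)) = weaklyAcyclicAt-embed left (waA q)
  union-weaklyAcyclic waA waB (inj₂ (inj₂ q)) = weaklyAcyclicAt-embed right (waB q)
  union-weaklyAcyclic waA waB fresh w≢[] ε = contradiction refl w≢[]
  union-weaklyAcyclic waA waB fresh _ (_◅_ {p = inj₂ (inj₁ _)} _ ρ) with () ← run-reflect left ρ refl
  union-weaklyAcyclic waA waB fresh _ (_◅_ {p = inj₂ (inj₂ _)} _ ρ) with () ← run-reflect right ρ refl

module _ {k : ℕ} where
  open Automaton
  open Prefix using (prefix; prefix-accepts; prefix-weaklyAcyclic)
  open Union using (union; union-accepts; union-weaklyAcyclic)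

  Prefixed-cong : ∀ {Λ a} {L M : Language k} → L ≐ M → Prefixed Λ a L ≐ Prefixed Λ a M
  Prefixed-cong L≐M w = mk⇔
    (λ (u , v , w≡ , us , h) → u , v , w≡ , us , to (L≐M v) h)
    (λ (u , v , w≡ , us , h) → u , v , w≡ , us , from (L≐M v) h)

  automaton : WAExpr k → Automaton k
  automaton ∅                  = loops (λ _ → false) false
  automaton (Γ *)              = loops Γ true
  automaton ((Λ *· a · a∉Λ) r) = prefix Λ a a∉Λ (automaton r)
  automaton (r ⊕ s)            = union (automaton r) (automaton s)

  automaton-accepts : ∀ r → ⟦ r ⟧ ≐ accepts (automaton r)
  automaton-accepts ∅                  = ≐-trans (λ _ → mk⇔ (λ ()) (λ ())) loops-accepts
  automaton-accepts (Γ *)              = ≐-trans (λ _ → mk⇔ (refl ,_) proj₂) loops-accepts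
  automaton-accepts ((Λ *· a · a∉Λ) r) = ≐-trans (Prefixed-cong (automaton-accepts r)) (prefix-accepts Λ a a∉Λ _)
  automaton-accepts (r ⊕ s)            =
    ≐-trans (λ w → automaton-accepts r w ⊎-⇔ automaton-accepts s w) (union-accepts _ _)

  automaton-weaklyAcyclic : ∀ r → WeaklyAcyclic (automaton r)
  automaton-weaklyAcyclic ∅                  = loops-weaklyAcyclic
  automaton-weaklyAcyclic (Γ *)              = loops-weaklyAcyclic
  automaton-weaklyAcyclic ((Λ *· a · a∉Λ) r) = prefix-weaklyAcyclic Λ a a∉Λ _ (automaton-weaklyAcyclic r)
  automaton-weaklyAcyclic (r ⊕ s)            =
    union-weaklyAcyclic _ _ (automaton-weaklyAcyclic r) (automaton-weaklyAcyclic s)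

WAExpr→NFA : ∀ {k} (r : WAExpr k) → WA-NFA-Language ⟦ r ⟧
WAExpr→NFA r = WA-NFA-Language-resp (automaton-accepts r) (Automaton→NFA (automaton r) (automaton-weaklyAcyclic r))

module _ {k : ℕ} (A : DFA k) where
  open DFA A

  dfa-automaton : Automaton k
  dfa-automaton = record
    { State = Fin n ; size = n ; enum = ↔-id _
    ; Edge = λ q c p → δ q c ≡ p ; edge? = λ q c p → δ q c Fin.≟ p
    ; start = q₀ ; Final = λ q → F q ≡ true ; final? = λ q → F q Bool.≟ true
    }

  open Automaton dfa-automaton using (Run; ε; _◅_; accepts; WeaklyAcyclic)

  run⇔δ* : ∀ {q w p} → Run q w p ⇔ δ* A q w ≡ p
  run⇔δ* = mk⇔ endpoint run
    where
      endpoint : ∀ {q w p} → Run q w p → δ* A q w ≡ p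
      endpoint ε          = refl
      endpoint (refl ◅ ρ) = endpoint ρ
      run : ∀ {q w p} → δ* A q w ≡ p → Run q w p
      run {w = []}    refl = ε
      run {w = c ∷ w} eq   = refl ◅ run eq

  dfa-accepts : DFA-lang A ≐ accepts
  dfa-accepts w = mk⇔
    (λ final → _ , from run⇔δ* refl , final)
    (λ (_ , ρ , final) → subst (λ p → F p ≡ true) (sym (to run⇔δ* ρ)) final)

  dfa-weaklyAcyclic : DFA-WeaklyAcyclic A → WeaklyAcyclic
  dfa-weaklyAcyclic wa q w≢[] ρ {c} c∈w p =
    mk⇔ (λ δqc≡p → trans (sym δqc≡p) δqc≡q) (λ p≡q → trans δqc≡q (sym p≡q))
    where
      δqc≡q : δ q c ≡ q
      δqc≡q = wa q _ c w≢[] c∈w (to run⇔δ* ρ)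

  DFA→NFA : DFA-WeaklyAcyclic A → WA-NFA-Language (DFA-lang A)
  DFA→NFA wa = WA-NFA-Language-resp dfa-accepts (Automaton→NFA dfa-automaton (dfa-weaklyAcyclic wa))

corollary1 : (k : ℕ) (L : Language k) →
    WeaklyAcyclicLanguage L ⇔ Σ (WAExpr k) (λ r → L ≐ ⟦ r ⟧)
corollary1 k L = mk⇔ expression recognition
  where
    expression : WeaklyAcyclicLanguage L → Σ (WAExpr k) (λ r → L ≐ ⟦ r ⟧)
    expression (inj₁ (A , wa , L≐A)) = NFA→WAExpr (WA-NFA-Language-resp L≐A (DFA→NFA A wa))
    expression (inj₂ nfa)            = NFA→WAExpr nfa
    recognition : Σ (WAExpr k) (λ r → L ≐ ⟦ r ⟧) → WeaklyAcyclicLanguage L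
    recognition (r , L≐r) = inj₂ (WA-NFA-Language-resp L≐r (WAExpr→NFA r))
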